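{- Let $p=3$, $k=0$, $e\ge1$, and $n=3^{l_1}+3^{l_2}+3^{l_3}+3^{l_4}$ where $l_1,l_2,l_3,l_4$ are non-negative integers. Assume that exactly two of $l_1,l_2,l_3,l_4$ are zero and the two non-zero ones have the same parity. Then $D_{n,0}(1,x)$ is not a permutation polynomial of $\mathbb{F}_{3^e}$.
   Context: For an odd prime $p$ and $0\le k\le p-1$: for $n\ge 1$, $D_{n,k}(1,x)=\sum_{i=0}^{\lfloor n/2\rfloor}\frac{n-ki}{n-i}\binom{n-i}{i}(-x)^i$, where the coefficient is the integer $\binom{n-i}{i}-(k-1)\binom{n-i-1}{i-1}$ (with $\binom{m}{ -1}=0$) viewed in $\mathbb{F}_p$; $D_{0,k}(1,x)=2-k$. Equivalently $D_{1,k}=1$ and $D_{n,k}=D_{n-1,k}-xD_{n-2,k}$ for $n\ge2$. A polynomial over $\mathbb{F}_q$ is a permutation polynomial of $\mathbb{F}_q$ if it induces a bijection of $\mathbb{F}_q$. -}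

module Defs where

open import Level using (Level; _⊔_) renaming (suc to lsuc)
open import Algebra.Bundles using (CommutativeRing)
open import Data.Nat using (ℕ; zero; suc; _∸_; _^_; _%_; _/_) renaming (_+_ to _+ℕ_)
open import Data.Nat.Combinatorics using (_C_)
open import Data.Integer using (ℤ; +_; -[1+_]) renaming (_-_ to _-ℤ_; _*_ to _*ℤ_)
open import Data.Fin using (Fin)
open import Data.List using (List; foldr; map; upTo)
open import Data.Product using (Σ; _×_)
open import Relation.Nullary using (¬_)
open import Relation.Binary.PropositionalEquality using (_≡_)

record FiniteField (c ℓ : Level) (q : ℕ) : Set (lsuc (c ⊔ ℓ)) where
  field
    commRing : CommutativeRing c ℓ
  open CommutativeRing commRing public
  field
    1≉0     : ¬ (1# ≈ 0#)
    inverse : ∀ x → ¬ (x ≈ 0#) → Σ Carrier (λ y → (x * y) ≈ 1#)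
    enum    : Fin q → Carrier
    enum-injective  : ∀ i j → enum i ≈ enum j → i ≡ j
    enum-surjective : ∀ x → Σ (Fin q) (λ i → enum i ≈ x)

module _ {c ℓ : Level} {q : ℕ} (F : FiniteField c ℓ q) where
  open FiniteField F

  fromℕ : ℕ → Carrier
  fromℕ zero    = 0#
  fromℕ (suc n) = 1# + fromℕ n

  fromℤ : ℤ → Carrier
  fromℤ (+ n)    = fromℕ n
  fromℤ -[1+ n ] = - fromℕ (suc n)

  pow : Carrier → ℕ → Carrier
  pow x zero    = 1#
  pow x (suc n) = x * pow x n

  -- binom(n-i-1, i-1), with binom(m, -1) = 0
  binomShift : ℕ → ℕ → ℕ
  binomShift n zero    = 0
  binomShift n (suc j) = (n ∸ suc j ∸ 1) C j

  coeffD : ℕ → ℕ → ℕ → ℤ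
  coeffD n k i = (+ ((n ∸ i) C i)) -ℤ ((+ k -ℤ + 1) *ℤ (+ binomShift n i))

  D : ℕ → ℕ → Carrier → Carrier
  D zero    k x = fromℤ (+ 2 -ℤ + k)
  D (suc m) k x =
    foldr _+_ 0# (map (λ i → fromℤ (coeffD (suc m) k i) * pow (- x) i) (upTo (suc (suc m / 2))))

  IsPermutation : (Carrier → Carrier) → Set (c ⊔ ℓ)
  IsPermutation f =
    (∀ x y → f x ≈ f y → x ≈ y) × (∀ y → Σ Carrier (λ x → f x ≈ y))

isZero : ℕ → ℕ
isZero zero    = 1
isZero (suc _) = 0

ExactlyTwoZero : ℕ → ℕ → ℕ → ℕ → Set
ExactlyTwoZero l₁ l₂ l₃ l₄ = isZero l₁ +ℕ isZero l₂ +ℕ isZero l₃ +ℕ isZero l₄ ≡ 2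

SameParityIfNonzero : ℕ → ℕ → Set
SameParityIfNonzero a b = ¬ (a ≡ 0) → ¬ (b ≡ 0) → a % 2 ≡ b % 2

NonzeroSameParity : ℕ → ℕ → ℕ → ℕ → Set
NonzeroSameParity l₁ l₂ l₃ l₄ =
  SameParityIfNonzero l₁ l₂ × SameParityIfNonzero l₁ l₃ × SameParityIfNonzero l₁ l₄ ×
  SameParityIfNonzero l₂ l₃ × SameParityIfNonzero l₂ l₄ × SameParityIfNonzero l₃ l₄

module Submission where

-- Let n = 3^l₁ + 3^l₂ + 3^l₃ + 3^l₄ with exactly two lᵢ zero, so n = 3^A + 3^B + 2 with
-- A, B ≥ 1 of equal parity. We exhibit two distinct points of F = 𝔽_{3^e} on which
-- D_{n,0}(1,x) agrees. The argument rests on three general facts: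
--  (1) Recurrence. For k = 0 the coefficient of (-x)^i is C(n-i,i) + C(n-i-1,i-1), so
--      with y = -x and the Fibonacci sums G_n(y) = Σ_i C(n-i,i) yⁱ we get
--      D_{n+2,0} = G_{n+2} + y·G_n; Pascal's rule gives G_{n+2} = G_{n+1} + y·G_n, hence
--      D_{n+2,0} = D_{n+1,0} - x·D_{n,0}.
--  (2) Characteristic. Translation by 1 permutes F, so Σ_{a∈F} a = Σ_{a∈F} (a+1) and
--      q·1 = 0; since F is a field and q = 3^e, the element 3 cannot be invertible.
--  (3) Evaluations. D_{m+1,0}(0) = 1; the sequence D_{m,0}(1) is antiperiodic with
--      period 3, and in characteristic 3 the sequence D_{m,0}(-1) with period 4.
-- Modular arithmetic gives n ≡ 2 (mod 6), and n ≡ 0 (mod 8) when A, B are odd,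
-- n ≡ 4 (mod 8) when they are even. In the first case D_n(1) = D_n(-1) = 2, in the
-- second D_n(0) = D_n(-1) = 1, contradicting injectivity as 1 ≠ -1 and 0 ≠ -1.
-- Module Arithmetic collects the facts about ℕ and ℤ, module FieldFacts proves (1)-(3) and
-- the non-injectivity for an arbitrary finite field, and mainTheorem17 only puts n in shape.

open import Defs
open import Level using (Level)
open import Data.Nat using (ℕ)

module Arithmetic where

  open import Data.Nat using (zero; suc; _+_; _*_; _∸_; _^_; _≤_; _<_; z≤n; s≤s; _%_; _/_)
  open import Data.Nat.Properties
  open import Data.Nat.DivMod using (m≡m%n+[m/n]*n; m%n<n; m/n≤m; m/n≡1+[m∸n]/n)
  open import Data.Nat.Combinatorics using (_C_; k>n⇒nCk≡0; nCk+nC[k+1]≡[n+1]C[k+1])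
  open import Data.Nat.Tactic.RingSolver using (solve-∀)
  open import Data.Integer as ℤ using (+_)
  open import Data.Product using (Σ; ∃₂; _×_; _,_)
  open import Data.Sum using (_⊎_; inj₁; inj₂)
  open import Relation.Nullary using (yes; no)
  open import Relation.Binary.PropositionalEquality

  binom-vanish : ∀ n i → n < i + i → (n ∸ i) C i ≡ 0
  binom-vanish n zero    ()
  binom-vanish n (suc i) n<2i = k>n⇒nCk≡0 (m<n+o⇒m∸n<o n (suc i) n<2i)

  -- Indices beyond ⌊n/2⌋ satisfy 2i > n: the sum defining D stops where the terms vanish.
  half-bound : ∀ n i → suc (n / 2) ≤ i → n < i + i
  half-bound n i le = begin-strict
      n                         ≡⟨ m≡m%n+[m/n]*n n 2 ⟩
      n % 2 + (n / 2) * 2       <⟨ +-monoˡ-< ((n / 2) * 2) (m%n<n n 2) ⟩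
      2 + (n / 2) * 2           ≡⟨ double-suc (n / 2) ⟩
      suc (n / 2) + suc (n / 2) ≤⟨ +-mono-≤ le le ⟩
      i + i                     ∎
    where
    open ≤-Reasoning
    double-suc : ∀ m → 2 + m * 2 ≡ suc m + suc m
    double-suc = solve-∀

  half≤suc : ∀ n → suc (n / 2) ≤ suc n
  half≤suc n = s≤s (m/n≤m n 2)

  half-suc-suc : ∀ k → suc (suc k) / 2 ≡ suc (k / 2)
  half-suc-suc k = m/n≡1+[m∸n]/n {suc (suc k)} {2} (s≤s (s≤s z≤n))

  pascal-diag : ∀ n i → (suc n ∸ i) C suc i ≡ (n ∸ i) C suc i + (n ∸ i) C i
  pascal-diag n i with i ≤? n
  ... | yes i≤n = begin
      (suc n ∸ i) C suc i                ≡⟨ cong (_C suc i) (+-∸-assoc 1 i≤n) ⟩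
      suc (n ∸ i) C suc i                ≡⟨ nCk+nC[k+1]≡[n+1]C[k+1] (n ∸ i) i ⟨
      (n ∸ i) C i + (n ∸ i) C suc i      ≡⟨ +-comm ((n ∸ i) C i) _ ⟩
      (n ∸ i) C suc i + (n ∸ i) C i      ∎
    where open ≡-Reasoning
  ... | no i≰n = trans (k>n⇒nCk≡0 (≤-<-trans (m∸n≤m (suc n) i) (s≤s n<i)))
                   (sym (cong₂ _+_ (k>n⇒nCk≡0 (≤-<-trans (m∸n≤m n i) (m<n⇒m<1+n n<i)))
                                  (k>n⇒nCk≡0 (≤-<-trans (m∸n≤m n i) n<i))))
    where n<i = ≰⇒> i≰n

  -- The upper index of C(n-i-1, i-1) for n = k+2, i = j+1.
  shift-index : ∀ k j → suc (suc k) ∸ suc j ∸ 1 ≡ k ∸ j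
  shift-index k j = trans (∸-+-assoc (suc k) j 1) (cong (suc k ∸_) (+-comm j 1))

  coeff-k0 : ∀ a b → + a ℤ.- ((+ 0 ℤ.- + 1) ℤ.* + b) ≡ + (a + b)
  coeff-k0 a zero    = refl
  coeff-k0 a (suc b) = cong (λ m → + (a + suc m)) (+-identityʳ b)

  parity : ∀ a → a % 2 ≡ 0 ⊎ a % 2 ≡ 1
  parity zero          = inj₁ refl
  parity (suc zero)    = inj₂ refl
  parity (suc (suc a)) = parity a

  pow3-mod8 : ∀ a → Σ ℕ λ t → 3 ^ a ≡ 8 * t + 3 ^ (a % 2)
  pow3-mod8 zero          = 0 , refl
  pow3-mod8 (suc zero)    = 0 , refl
  pow3-mod8 (suc (suc a)) with pow3-mod8 a
  ... | t , eq = 9 * t + 3 ^ (a % 2) , trans (cong (λ m → 3 * (3 * m)) eq) (times9 t (3 ^ (a % 2)))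
    where
    times9 : ∀ t r → 3 * (3 * (8 * t + r)) ≡ 8 * (9 * t + r) + r
    times9 = solve-∀

  pow3-odd : ∀ a → Σ ℕ λ t → 3 ^ a ≡ 2 * t + 1
  pow3-odd zero    = 0 , refl
  pow3-odd (suc a) with pow3-odd a
  ... | t , eq = 3 * t + 1 , trans (cong (3 *_) eq) (times3 t)
    where
    times3 : ∀ t → 3 * (2 * t + 1) ≡ 2 * (3 * t + 1) + 1
    times3 = solve-∀

  -- 3^(a+1) + 3^(b+1) + 2 ≡ 3 + 3 + 2 ≡ 2 (mod 6).
  shape-mod6 : ∀ a b → Σ ℕ λ s → 3 ^ suc a + 3 ^ suc b + 2 ≡ s * 6 + 2
  shape-mod6 a b with pow3-odd a | pow3-odd b
  ... | t , eA | u , eB = t + u + 1 , trans (cong₂ (λ x y → 3 * x + 3 * y + 2) eA eB) (collect t u)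
    where
    collect : ∀ t u → 3 * (2 * t + 1) + 3 * (2 * u + 1) + 2 ≡ (t + u + 1) * 6 + 2
    collect = solve-∀

  -- 3^A + 3^B + 2 with A ≡ B (mod 2) is ≡ 3 + 3 + 2 ≡ 0 (mod 8) for odd and ≡ 1 + 1 + 2 (mod 8)
  -- for even exponents.
  shape-mod8 : ∀ A B → A % 2 ≡ B % 2 →
    (Σ ℕ λ T → 3 ^ A + 3 ^ B + 2 ≡ T * 8 + 0) ⊎ (Σ ℕ λ T → 3 ^ A + 3 ^ B + 2 ≡ T * 8 + 4)
  shape-mod8 A B same with pow3-mod8 A | pow3-mod8 B | parity B
  ... | t , eA | u , eB | inj₁ even rewrite eA | eB | same | even = inj₂ (t + u , collect t u)
    where
    collect : ∀ t u → 8 * t + 1 + (8 * u + 1) + 2 ≡ (t + u) * 8 + 4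
    collect = solve-∀
  ... | t , eA | u , eB | inj₂ odd  rewrite eA | eB | same | odd  = inj₁ (t + u + 1 , collect t u)
    where
    collect : ∀ t u → 8 * t + 3 + (8 * u + 3) + 2 ≡ (t + u + 1) * 8 + 0
    collect = solve-∀

  private
    zeros₁₂ : ∀ X Y → 1 + 1 + X + Y ≡ X + Y + 2
    zeros₁₂ = solve-∀
    zeros₁₃ : ∀ X Y → 1 + X + 1 + Y ≡ X + Y + 2
    zeros₁₃ = solve-∀
    zeros₁₄ : ∀ X Y → 1 + X + Y + 1 ≡ X + Y + 2
    zeros₁₄ = solve-∀
    zeros₂₃ : ∀ X Y → X + 1 + 1 + Y ≡ X + Y + 2
    zeros₂₃ = solve-∀
    zeros₂₄ : ∀ X Y → X + 1 + Y + 1 ≡ X + Y + 2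
    zeros₂₄ = solve-∀
    zeros₃₄ : ∀ X Y → X + Y + 1 + 1 ≡ X + Y + 2
    zeros₃₄ = solve-∀

  two-powers-plus-two : ∀ l₁ l₂ l₃ l₄ → ExactlyTwoZero l₁ l₂ l₃ l₄ → NonzeroSameParity l₁ l₂ l₃ l₄ →
    ∃₂ λ a b → suc a % 2 ≡ suc b % 2 × 3 ^ l₁ + 3 ^ l₂ + 3 ^ l₃ + 3 ^ l₄ ≡ 3 ^ suc a + 3 ^ suc b + 2
  two-powers-plus-two zero zero (suc a) (suc b) _ (_ , _ , _ , _ , _ , p) =
    a , b , p (λ ()) (λ ()) , zeros₁₂ (3 ^ suc a) (3 ^ suc b)
  two-powers-plus-two zero (suc a) zero (suc b) _ (_ , _ , _ , _ , p , _) =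
    a , b , p (λ ()) (λ ()) , zeros₁₃ (3 ^ suc a) (3 ^ suc b)
  two-powers-plus-two zero (suc a) (suc b) zero _ (_ , _ , _ , p , _ , _) =
    a , b , p (λ ()) (λ ()) , zeros₁₄ (3 ^ suc a) (3 ^ suc b)
  two-powers-plus-two (suc a) zero zero (suc b) _ (_ , _ , p , _ , _ , _) =
    a , b , p (λ ()) (λ ()) , zeros₂₃ (3 ^ suc a) (3 ^ suc b)
  two-powers-plus-two (suc a) zero (suc b) zero _ (_ , p , _ , _ , _ , _) =
    a , b , p (λ ()) (λ ()) , zeros₂₄ (3 ^ suc a) (3 ^ suc b)
  two-powers-plus-two (suc a) (suc b) zero zero _ (p , _ , _ , _ , _ , _) =
    a , b , p (λ ()) (λ ()) , zeros₃₄ (3 ^ suc a) (3 ^ suc b)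
  two-powers-plus-two zero    zero    zero    zero    () _
  two-powers-plus-two zero    zero    zero    (suc _) () _
  two-powers-plus-two zero    zero    (suc _) zero    () _
  two-powers-plus-two zero    (suc _) zero    zero    () _
  two-powers-plus-two (suc _) zero    zero    zero    () _
  two-powers-plus-two zero    (suc _) (suc _) (suc _) () _
  two-powers-plus-two (suc _) zero    (suc _) (suc _) () _
  two-powers-plus-two (suc _) (suc _) zero    (suc _) () _
  two-powers-plus-two (suc _) (suc _) (suc _) zero    () _
  two-powers-plus-two (suc _) (suc _) (suc _) (suc _) () _

module FieldFacts {c ℓ : Level} {q : ℕ} (F : FiniteField c ℓ q) where

  open import Data.Nat using (zero; suc; _∸_; _^_; _≤_; _<_; _/_; _%_)
    renaming (_+_ to _+ℕ_; _*_ to _*ℕ_)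
  import Data.Nat.Properties as ℕₚ
  open import Data.Nat.Combinatorics using (_C_)
  open import Data.List using (foldr; applyUpTo)
  open import Data.List.Properties using (map-upTo)
  open import Data.Fin using (Fin)
  open import Data.Fin.Permutation using (permutation; Permutation′)
  open import Data.Product using (_,_; proj₁; proj₂)
  open import Data.Sum using (inj₁; inj₂)
  open import Data.Maybe using (nothing)
  open import Function using (_∘_)
  open import Relation.Nullary using (¬_)
  import Relation.Binary.PropositionalEquality as P
  open import Tactic.RingSolver.Core.AlmostCommutativeRing using (fromCommutativeRing)
  open Arithmetic

  open FiniteField F
  open import Algebra.Properties.Ring ring using (-‿involutive; -0#≈0#; -1*x≈-x)
  open import Algebra.Properties.Group +-group using (inverseʳ-unique; loop)
  open import Algebra.Properties.Loop loop using (identityʳ-unique)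
  import Algebra.Properties.CommutativeMonoid.Sum +-commutativeMonoid as FinSum
  import Algebra.Solver.CommutativeMonoid +-commutativeMonoid as CM
  open import Tactic.RingSolver.NonReflective (fromCommutativeRing commRing (λ _ → nothing))
    using (solve; _⊕_; _⊗_)
  open import Relation.Binary.Reasoning.Setoid setoid

  ι : ℕ → Carrier
  ι = fromℕ F

  D₀ : ℕ → Carrier → Carrier
  D₀ m = D F m 0

  ι-+ : ∀ a b → ι (a +ℕ b) ≈ ι a + ι b
  ι-+ zero    b = sym (+-identityˡ _)
  ι-+ (suc a) b = trans (+-congˡ (ι-+ a b)) (sym (+-assoc _ _ _))

  ι-* : ∀ a b → ι (a *ℕ b) ≈ ι a * ι b
  ι-* zero    b = sym (zeroˡ _)
  ι-* (suc a) b = begin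
    ι (b +ℕ a *ℕ b)            ≈⟨ ι-+ b (a *ℕ b) ⟩
    ι b + ι (a *ℕ b)           ≈⟨ +-cong (sym (*-identityˡ _)) (ι-* a b) ⟩
    1# * ι b + ι a * ι b       ≈⟨ distribʳ _ _ _ ⟨
    (1# + ι a) * ι b           ∎

  sumTo : (ℕ → Carrier) → ℕ → Carrier
  sumTo h N = foldr _+_ 0# (applyUpTo h N)

  sumTo-cong : ∀ {h g} N → (∀ i → h i ≈ g i) → sumTo h N ≈ sumTo g N
  sumTo-cong zero    h≈g = refl
  sumTo-cong (suc N) h≈g = +-cong (h≈g 0) (sumTo-cong N (h≈g ∘ suc))

  sumTo-snoc : ∀ h N → sumTo h (suc N) ≈ sumTo h N + h N
  sumTo-snoc h zero    = trans (+-identityʳ _) (sym (+-identityˡ _))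
  sumTo-snoc h (suc N) = trans (+-congˡ (sumTo-snoc (h ∘ suc) N)) (sym (+-assoc _ _ _))

  sumTo-+ : ∀ h g N → sumTo (λ i → h i + g i) N ≈ sumTo h N + sumTo g N
  sumTo-+ h g zero    = sym (+-identityʳ _)
  sumTo-+ h g (suc N) = trans (+-congˡ (sumTo-+ (h ∘ suc) (g ∘ suc) N)) (interchange _ _ _ _)
    where
    interchange : ∀ a b c d → (a + b) + (c + d) ≈ (a + c) + (b + d)
    interchange = solve 4 (λ a b c d → (a ⊕ b) ⊕ (c ⊕ d) , (a ⊕ c) ⊕ (b ⊕ d)) refl

  sumTo-* : ∀ y h N → sumTo (λ i → y * h i) N ≈ y * sumTo h N
  sumTo-* y h zero    = sym (zeroʳ y)
  sumTo-* y h (suc N) = trans (+-congˡ (sumTo-* y (h ∘ suc) N)) (sym (distribˡ y _ _))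

  sumTo-pad : ∀ h N d → (∀ i → N ≤ i → h i ≈ 0#) → sumTo h N ≈ sumTo h (N +ℕ d)
  sumTo-pad h N zero    h≈0 = reflexive (P.cong (sumTo h) (P.sym (ℕₚ.+-identityʳ N)))
  sumTo-pad h N (suc d) h≈0 = begin
    sumTo h N                        ≈⟨ sumTo-pad h N d h≈0 ⟩
    sumTo h (N +ℕ d)                 ≈⟨ +-identityʳ _ ⟨
    sumTo h (N +ℕ d) + 0#            ≈⟨ +-congˡ (h≈0 (N +ℕ d) (ℕₚ.m≤m+n N d)) ⟨
    sumTo h (N +ℕ d) + h (N +ℕ d)    ≈⟨ sumTo-snoc h (N +ℕ d) ⟨
    sumTo h (suc (N +ℕ d))           ≡⟨ P.cong (sumTo h) (ℕₚ.+-suc N d) ⟨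
    sumTo h (N +ℕ suc d)             ∎

  sumTo-truncate : ∀ h N M → N ≤ M → (∀ i → N ≤ i → h i ≈ 0#) → sumTo h N ≈ sumTo h M
  sumTo-truncate h N M N≤M h≈0 =
    P.subst (λ K → sumTo h N ≈ sumTo h K) (ℕₚ.m+[n∸m]≡n N≤M) (sumTo-pad h N (M ∸ N) h≈0)

  fibTerm : Carrier → ℕ → ℕ → Carrier
  fibTerm y n i = ι ((n ∸ i) C i) * pow F y i

  fibSum : Carrier → ℕ → Carrier
  fibSum y n = sumTo (fibTerm y n) (suc n)

  fibTerm-vanish : ∀ y n i → n < i +ℕ i → fibTerm y n i ≈ 0#
  fibTerm-vanish y n i n<2i = trans (*-congʳ (reflexive (P.cong ι (binom-vanish n i n<2i)))) (zeroˡ _)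

  fibSum-range : ∀ y n M → suc (n / 2) ≤ M → sumTo (fibTerm y n) M ≈ fibSum y n
  fibSum-range y n M le = begin
    sumTo (fibTerm y n) M                 ≈⟨ sumTo-truncate (fibTerm y n) (suc (n / 2)) M le vanish ⟨
    sumTo (fibTerm y n) (suc (n / 2))     ≈⟨ sumTo-truncate (fibTerm y n) (suc (n / 2)) (suc n) (half≤suc n) vanish ⟩
    fibSum y n                            ∎
    where
    vanish : ∀ i → suc (n / 2) ≤ i → fibTerm y n i ≈ 0#
    vanish i le = fibTerm-vanish y n i (half-bound n i le)

  fibSum-rec : ∀ y n → fibSum y (suc (suc n)) ≈ fibSum y (suc n) + y * fibSum y n
  fibSum-rec y n = begin
    fibTerm y (2 +ℕ n) 0 + sumTo (fibTerm y (2 +ℕ n) ∘ suc) (2 +ℕ n)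
      ≈⟨ +-congˡ (sumTo-cong (2 +ℕ n) pascal-term) ⟩
    fibTerm y (1 +ℕ n) 0 + sumTo (λ i → fibTerm y (1 +ℕ n) (suc i) + y * fibTerm y n i) (2 +ℕ n)
      ≈⟨ +-congˡ (sumTo-+ (fibTerm y (1 +ℕ n) ∘ suc) (λ i → y * fibTerm y n i) (2 +ℕ n)) ⟩
    fibTerm y (1 +ℕ n) 0 + (sumTo (fibTerm y (1 +ℕ n) ∘ suc) (2 +ℕ n) + sumTo (λ i → y * fibTerm y n i) (2 +ℕ n))
      ≈⟨ +-assoc _ _ _ ⟨
    sumTo (fibTerm y (1 +ℕ n)) (3 +ℕ n) + sumTo (λ i → y * fibTerm y n i) (2 +ℕ n)
      ≈⟨ +-cong (fibSum-range y (1 +ℕ n) (3 +ℕ n) (past-half (1 +ℕ n))) (sumTo-* y (fibTerm y n) (2 +ℕ n)) ⟩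
    fibSum y (1 +ℕ n) + y * sumTo (fibTerm y n) (2 +ℕ n)
      ≈⟨ +-congˡ (*-congˡ (fibSum-range y n (2 +ℕ n) (past-half n))) ⟩
    fibSum y (1 +ℕ n) + y * fibSum y n ∎
    where
    rearrange : ∀ a b y p → (a + b) * (y * p) ≈ a * (y * p) + y * (b * p)
    rearrange = solve 4 (λ a b y p → (a ⊕ b) ⊗ (y ⊗ p) , a ⊗ (y ⊗ p) ⊕ y ⊗ (b ⊗ p)) refl
    pascal-term : ∀ i → fibTerm y (2 +ℕ n) (suc i) ≈ fibTerm y (1 +ℕ n) (suc i) + y * fibTerm y n i
    pascal-term i = trans (*-congʳ (trans (reflexive (P.cong ι (pascal-diag n i))) (ι-+ ((n ∸ i) C suc i) ((n ∸ i) C i))))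
                          (rearrange _ _ y _)
    past-half : ∀ m → suc (m / 2) ≤ suc (suc m)
    past-half m = ℕₚ.≤-trans (half≤suc m) (ℕₚ.n≤1+n (suc m))

  D₀-as-sum : ∀ m x →
    D₀ (suc m) x P.≡ sumTo (λ i → fromℤ F (coeffD F (suc m) 0 i) * pow F (- x) i) (suc (suc m / 2))
  D₀-as-sum m x = P.cong (foldr _+_ 0#) (map-upTo _ (suc (suc m / 2)))

  -- D_{k+2,0}(x) = G_{k+2}(y) + y·G_k(y) with y = -x: the coefficient of yⁱ is
  -- C(k+2-i, i) + C(k+1-i, i-1), and the second family is the coefficients of y·G_k.
  D₀-fib : ∀ k x → D₀ (suc (suc k)) x ≈ fibSum (- x) (suc (suc k)) + (- x) * fibSum (- x) k
  D₀-fib k x = begin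
    D₀ n x
      ≡⟨ D₀-as-sum (suc k) x ⟩
    sumTo (λ i → fromℤ F (coeffD F n 0 i) * pow F y i) (suc M)
      ≈⟨ sumTo-cong (suc M) split ⟩
    sumTo (λ i → fibTerm y n i + shiftTerm i) (suc M)
      ≈⟨ sumTo-+ (fibTerm y n) shiftTerm (suc M) ⟩
    sumTo (fibTerm y n) (suc M) + (shiftTerm 0 + sumTo (shiftTerm ∘ suc) M)
      ≈⟨ +-cong (fibSum-range y n (suc M) ℕₚ.≤-refl) (+-cong (zeroˡ _) shifted) ⟩
    fibSum y n + (0# + y * fibSum y k)
      ≈⟨ +-congˡ (+-identityˡ _) ⟩
    fibSum y n + y * fibSum y k
      ∎
    where
    y = - x
    n = suc (suc k)
    M = n / 2
    shiftTerm : ℕ → Carrier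
    shiftTerm i = ι (binomShift F n i) * pow F y i
    split : ∀ i → fromℤ F (coeffD F n 0 i) * pow F y i ≈ fibTerm y n i + shiftTerm i
    split i = trans (*-congʳ (trans (reflexive (P.cong (fromℤ F) (coeff-k0 ((n ∸ i) C i) (binomShift F n i))))
                                   (ι-+ ((n ∸ i) C i) (binomShift F n i))))
                    (distribʳ _ _ _)
    swap : ∀ a b p → a * (b * p) ≈ b * (a * p)
    swap = solve 3 (λ a b p → a ⊗ (b ⊗ p) , b ⊗ (a ⊗ p)) refl
    shiftTerm-suc : ∀ j → shiftTerm (suc j) ≈ y * fibTerm y k j
    shiftTerm-suc j = trans (*-congʳ (reflexive (P.cong (λ m → ι (m C j)) (shift-index k j)))) (swap _ y _)
    shifted : sumTo (shiftTerm ∘ suc) M ≈ y * fibSum y k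
    shifted = begin
      sumTo (shiftTerm ∘ suc) M          ≈⟨ sumTo-cong M shiftTerm-suc ⟩
      sumTo (λ j → y * fibTerm y k j) M  ≈⟨ sumTo-* y (fibTerm y k) M ⟩
      y * sumTo (fibTerm y k) M          ≈⟨ *-congˡ (fibSum-range y k M (ℕₚ.≤-reflexive (P.sym (half-suc-suc k)))) ⟩
      y * fibSum y k                     ∎

  ι1·1≈1 : ι 1 * 1# ≈ 1#
  ι1·1≈1 = trans (*-identityʳ _) (+-identityʳ _)

  fibSum-zero : ∀ y → fibSum y 0 ≈ 1#
  fibSum-zero y = trans (+-identityʳ _) ι1·1≈1

  fibSum-one : ∀ y → fibSum y 1 ≈ 1#
  fibSum-one y = trans (+-cong ι1·1≈1 (trans (+-identityʳ _) (zeroˡ _))) (+-identityʳ _)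

  D₀-zero : ∀ x → D₀ 0 x ≈ 1# + 1#
  D₀-zero x = +-congˡ (+-identityʳ _)

  D₀-one : ∀ x → D₀ 1 x ≈ 1#
  D₀-one x = trans (+-identityʳ _) ι1·1≈1

  D₀-rec : ∀ m x → D₀ (suc (suc m)) x ≈ D₀ (suc m) x + (- x) * D₀ m x
  D₀-rec zero x = begin
    D₀ 2 x                            ≈⟨ D₀-fib 0 x ⟩
    fibSum y 2 + y * fibSum y 0       ≈⟨ +-cong (fibSum-rec y 0) (*-congˡ (fibSum-zero y)) ⟩
    (fibSum y 1 + y * fibSum y 0) + y * 1#
                                      ≈⟨ +-congʳ (+-cong (fibSum-one y) (*-congˡ (fibSum-zero y))) ⟩
    (1# + y * 1#) + y * 1#            ≈⟨ +-assoc _ _ _ ⟩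
    1# + (y * 1# + y * 1#)            ≈⟨ +-congˡ (distribˡ y 1# 1#) ⟨
    1# + y * (1# + 1#)                ≈⟨ +-cong (D₀-one x) (*-congˡ (D₀-zero x)) ⟨
    D₀ 1 x + y * D₀ 0 x               ∎
    where y = - x
  D₀-rec (suc zero) x = begin
    D₀ 3 x                            ≈⟨ D₀-fib 1 x ⟩
    fibSum y 3 + y * fibSum y 1       ≈⟨ +-cong (fibSum-rec y 1) (*-congˡ (fibSum-one y)) ⟩
    (fibSum y 2 + y * fibSum y 1) + y * 1#
                                      ≈⟨ +-congʳ (+-congˡ (*-congˡ (trans (fibSum-one y) (sym (fibSum-zero y))))) ⟩
    (fibSum y 2 + y * fibSum y 0) + y * 1#
                                      ≈⟨ +-cong (D₀-fib 0 x) (*-congˡ (D₀-one x)) ⟨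
    D₀ 2 x + y * D₀ 1 x               ∎
    where y = - x
  D₀-rec (suc (suc k)) x = begin
    D₀ (4 +ℕ k) x
      ≈⟨ D₀-fib (2 +ℕ k) x ⟩
    G (4 +ℕ k) + y * G (2 +ℕ k)
      ≈⟨ +-cong (fibSum-rec y (2 +ℕ k)) (*-congˡ (fibSum-rec y k)) ⟩
    (G (3 +ℕ k) + y * G (2 +ℕ k)) + y * (G (1 +ℕ k) + y * G k)
      ≈⟨ regroup _ _ _ _ y ⟩
    (G (3 +ℕ k) + y * G (1 +ℕ k)) + y * (G (2 +ℕ k) + y * G k)
      ≈⟨ +-cong (D₀-fib (1 +ℕ k) x) (*-congˡ (D₀-fib k x)) ⟨
    D₀ (3 +ℕ k) x + y * D₀ (2 +ℕ k) x
      ∎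
    where
    y = - x
    G = fibSum y
    regroup : ∀ a b c d y → (a + y * b) + y * (c + y * d) ≈ (a + y * c) + y * (b + y * d)
    regroup = solve 5 (λ a b c d y → (a ⊕ y ⊗ b) ⊕ y ⊗ (c ⊕ y ⊗ d) , (a ⊕ y ⊗ c) ⊕ y ⊗ (b ⊕ y ⊗ d)) refl

  antiperiodic : ∀ (u : ℕ → Carrier) m → (∀ n → u (m +ℕ n) ≈ - u n) →
                 ∀ T r → u (T *ℕ (m +ℕ m) +ℕ r) ≈ u r
  antiperiodic u m anti zero    r = refl
  antiperiodic u m anti (suc T) r = begin
    u ((m +ℕ m +ℕ T *ℕ (m +ℕ m)) +ℕ r)  ≡⟨ P.cong u regroup ⟩
    u (m +ℕ (m +ℕ rest))                ≈⟨ anti (m +ℕ rest) ⟩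
    - u (m +ℕ rest)                     ≈⟨ -‿cong (anti rest) ⟩
    - - u rest                          ≈⟨ -‿involutive _ ⟩
    u rest                              ≈⟨ antiperiodic u m anti T r ⟩
    u r                                 ∎
    where
    rest = T *ℕ (m +ℕ m) +ℕ r
    regroup : m +ℕ m +ℕ T *ℕ (m +ℕ m) +ℕ r P.≡ m +ℕ (m +ℕ rest)
    regroup = P.trans (ℕₚ.+-assoc (m +ℕ m) _ r) (ℕₚ.+-assoc m m rest)

  -- At x = 0 the recurrence reads u(m+2) = u(m+1), so D_{m+1,0}(0) = D_{1,0}(0) = 1.
  D₀-at-zero : ∀ m → D₀ (suc m) 0# ≈ 1#
  D₀-at-zero zero    = D₀-one 0#
  D₀-at-zero (suc m) = begin
    D₀ (2 +ℕ m) 0#                     ≈⟨ D₀-rec m 0# ⟩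
    D₀ (1 +ℕ m) 0# + (- 0#) * D₀ m 0#  ≈⟨ +-cong (D₀-at-zero m) (trans (*-congʳ -0#≈0#) (zeroˡ _)) ⟩
    1# + 0#                            ≈⟨ +-identityʳ 1# ⟩
    1#                                 ∎

  -- At x = 1 the recurrence reads u(m+2) = u(m+1) - u(m), hence u(m+3) = -u(m) and
  -- u(6s+2) = u(2) = 1 - 2.
  D₀-at-one : ∀ s → D₀ (s *ℕ 6 +ℕ 2) 1# ≈ 1# - (1# + 1#)
  D₀-at-one s = begin
    u (s *ℕ 6 +ℕ 2)          ≈⟨ antiperiodic u 3 three-step s 2 ⟩
    u 2                      ≈⟨ step 0 ⟩
    u 1 - u 0                ≈⟨ +-cong (D₀-one 1#) (-‿cong (D₀-zero 1#)) ⟩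
    1# - (1# + 1#)           ∎
    where
    u = λ m → D₀ m 1#
    step : ∀ m → u (2 +ℕ m) ≈ u (1 +ℕ m) - u m
    step m = trans (D₀-rec m 1#) (+-congˡ (-1*x≈-x _))
    cancel : ∀ a b → (b - a) - b ≈ - a
    cancel a b = begin
      (b - a) - b        ≈⟨ +-congʳ (+-comm b (- a)) ⟩
      (- a + b) - b      ≈⟨ +-assoc (- a) b (- b) ⟩
      - a + (b - b)      ≈⟨ +-congˡ (-‿inverseʳ b) ⟩
      - a + 0#           ≈⟨ +-identityʳ (- a) ⟩
      - a                ∎
    three-step : ∀ m → u (3 +ℕ m) ≈ - u m
    three-step m = trans (step (1 +ℕ m)) (trans (+-congʳ (step m)) (cancel (u m) (u (1 +ℕ m))))

  Char3 : Set ℓ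
  Char3 = ι 3 ≈ 0#

  triple-vanish : Char3 → ∀ a → a + (a + a) ≈ 0#
  triple-vanish char a = begin
    a + (a + a)                      ≈⟨ +-cong (*-identityˡ a) (+-cong (*-identityˡ a) (*-identityˡ a)) ⟨
    1# * a + (1# * a + 1# * a)       ≈⟨ +-congˡ (+-congˡ (*-congʳ (+-identityʳ 1#))) ⟨
    1# * a + (1# * a + ι 1 * a)      ≈⟨ +-congˡ (distribʳ a 1# (ι 1)) ⟨
    1# * a + ι 2 * a                 ≈⟨ distribʳ a 1# (ι 2) ⟨
    ι 3 * a                          ≈⟨ *-congʳ char ⟩
    0# * a                           ≈⟨ zeroˡ a ⟩
    0#                               ∎

  double≈negate : Char3 → ∀ a → a + a ≈ - a
  double≈negate char a = inverseʳ-unique a (a + a) (triple-vanish char a)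

  -- At x = -1 in characteristic 3 the recurrence reads u(m+2) = u(m+1) + u(m), hence
  -- u(m+4) = 3u(m+1) + 2u(m) = -u(m).
  D₀-at-minus-one-antiperiodic : Char3 → ∀ m → D₀ (4 +ℕ m) (- 1#) ≈ - D₀ m (- 1#)
  D₀-at-minus-one-antiperiodic char m = begin
    u (4 +ℕ m)                 ≈⟨ trans (step (2 +ℕ m)) (+-cong (trans (step (1 +ℕ m)) (+-congʳ (step m))) (step m)) ⟩
    ((b + a) + b) + (b + a)    ≈⟨ regroup a b ⟩
    (b + (b + b)) + (a + a)    ≈⟨ +-cong (triple-vanish char b) (double≈negate char a) ⟩
    0# - a                     ≈⟨ +-identityˡ _ ⟩
    - a                        ∎
    where
    u = λ m → D₀ m (- 1#)
    a = u m
    b = u (1 +ℕ m)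
    step : ∀ m → u (2 +ℕ m) ≈ u (1 +ℕ m) + u m
    step m = trans (D₀-rec m (- 1#)) (+-congˡ (trans (*-congʳ (-‿involutive 1#)) (*-identityˡ _)))
    regroup : ∀ a b → ((b + a) + b) + (b + a) ≈ (b + (b + b)) + (a + a)
    regroup = CM.solve 2 (λ a b → ((b CM.⊕ a) CM.⊕ b) CM.⊕ (b CM.⊕ a) CM.⊜ (b CM.⊕ (b CM.⊕ b)) CM.⊕ (a CM.⊕ a)) refl

  D₀-at-minus-one : Char3 → ∀ T r → D₀ (T *ℕ 8 +ℕ r) (- 1#) ≈ D₀ r (- 1#)
  D₀-at-minus-one char = antiperiodic (λ m → D₀ m (- 1#)) 4 (D₀-at-minus-one-antiperiodic char)

  translateIndex : Carrier → Fin q → Fin q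
  translateIndex a i = proj₁ (enum-surjective (enum i + a))

  translateIndex-inverse : ∀ a b → a + b ≈ 0# → ∀ i → translateIndex b (translateIndex a i) P.≡ i
  translateIndex-inverse a b a+b≈0 i = enum-injective _ _ (begin
    enum (translateIndex b (translateIndex a i))  ≈⟨ proj₂ (enum-surjective _) ⟩
    enum (translateIndex a i) + b                 ≈⟨ +-congʳ (proj₂ (enum-surjective _)) ⟩
    (enum i + a) + b                              ≈⟨ +-assoc _ _ _ ⟩
    enum i + (a + b)                              ≈⟨ +-congˡ a+b≈0 ⟩
    enum i + 0#                                   ≈⟨ +-identityʳ _ ⟩
    enum i                                        ∎)

  translateByOne : Permutation′ q
  translateByOne = permutation (translateIndex 1#) (translateIndex (- 1#))
    (translateIndex-inverse (- 1#) 1# (-‿inverseˡ 1#)) (translateIndex-inverse 1# (- 1#) (-‿inverseʳ 1#))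

  sum-ones : ∀ n → FinSum.sum {n} (λ _ → 1#) ≈ ι n
  sum-ones zero    = refl
  sum-ones (suc n) = +-congˡ (sum-ones n)

  -- Σ_{a∈F} a = Σ_{a∈F} (a + 1) = Σ_{a∈F} a + q·1, hence q·1 = 0 in F.
  size≈0 : ι q ≈ 0#
  size≈0 = identityʳ-unique total (ι q) (sym (begin
    total                                 ≈⟨ FinSum.sum-permute enum translateByOne ⟩
    FinSum.sum (enum ∘ translateIndex 1#) ≈⟨ FinSum.sum-cong-≋ {q} (λ i → proj₂ (enum-surjective (enum i + 1#))) ⟩
    FinSum.sum (λ i → enum i + 1#)        ≈⟨ FinSum.∑-distrib-+ enum (λ _ → 1#) ⟩
    total + FinSum.sum {q} (λ _ → 1#)     ≈⟨ +-congˡ (sum-ones q) ⟩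
    total + ι q                           ∎))
    where total = FinSum.sum enum

  ι-^ : ∀ a e → ι (a ^ e) ≈ pow F (ι a) e
  ι-^ a zero    = +-identityʳ 1#
  ι-^ a (suc e) = trans (ι-* a (a ^ e)) (*-congˡ (ι-^ a e))

  pow-inverse : ∀ t z → t * z ≈ 1# → ∀ e → pow F t e * pow F z e ≈ 1#
  pow-inverse t z tz≈1 zero    = *-identityˡ 1#
  pow-inverse t z tz≈1 (suc e) = begin
    (t * pow F t e) * (z * pow F z e)   ≈⟨ interchange t _ z _ ⟩
    (t * z) * (pow F t e * pow F z e)   ≈⟨ *-cong tz≈1 (pow-inverse t z tz≈1 e) ⟩
    1# * 1#                             ≈⟨ *-identityˡ 1# ⟩
    1#                                  ∎
    where
    interchange : ∀ a b c d → (a * b) * (c * d) ≈ (a * c) * (b * d)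
    interchange = solve 4 (λ a b c d → (a ⊗ b) ⊗ (c ⊗ d) , (a ⊗ c) ⊗ (b ⊗ d)) refl

  -- If q = p^e then p is not invertible in F, so (F being a field) p = 0 cannot be refuted.
  power-size⇒base-vanishes : ∀ p e → q P.≡ p ^ e → ¬ ¬ (ι p ≈ 0#)
  power-size⇒base-vanishes p e q≡pᵉ p≉0 with inverse (ι p) p≉0
  ... | z , pz≈1 = 1≉0 (begin
    1#                          ≈⟨ pow-inverse (ι p) z pz≈1 e ⟨
    pow F (ι p) e * pow F z e   ≈⟨ *-congʳ pᵉ≈0 ⟩
    0# * pow F z e              ≈⟨ zeroˡ _ ⟩
    0#                          ∎)
    where
    pᵉ≈0 : pow F (ι p) e ≈ 0#
    pᵉ≈0 = trans (sym (ι-^ p e)) (P.subst (λ m → ι m ≈ 0#) q≡pᵉ size≈0)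

  minus-two≈one : Char3 → - (1# + 1#) ≈ 1#
  minus-two≈one char = trans (-‿cong (double≈negate char 1#)) (-‿involutive 1#)

  one≉minus-one : Char3 → ¬ (1# ≈ - 1#)
  one≉minus-one char 1≈-1 = 1≉0 (begin
    1#                 ≈⟨ +-identityʳ 1# ⟨
    1# + 0#            ≈⟨ +-congˡ (-‿inverseʳ 1#) ⟨
    1# + (1# - 1#)     ≈⟨ +-congˡ (+-congˡ (sym 1≈-1)) ⟩
    1# + (1# + 1#)     ≈⟨ triple-vanish char 1# ⟩
    0#                 ∎)

  minus-one≉zero : ¬ (- 1# ≈ 0#)
  minus-one≉zero -1≈0 = 1≉0 (trans (sym (-‿involutive 1#)) (trans (-‿cong -1≈0) -0#≈0#))

  -- For odd A, B we have n ≡ 0 (mod 8) and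
  -- D_n(1) = D_2(1) = -1 = 2 = D_0(-1) = D_n(-1); for even A, B we have n ≡ 4 (mod 8) and
  -- D_n(-1) = D_4(-1) = -2 = 1 = D_n(0).
  D₀-not-injective : Char3 → ∀ a b → suc a % 2 P.≡ suc b % 2 →
    ¬ (∀ x y → D₀ (3 ^ suc a +ℕ 3 ^ suc b +ℕ 2) x ≈ D₀ (3 ^ suc a +ℕ 3 ^ suc b +ℕ 2) y → x ≈ y)
  D₀-not-injective char a b same injective with shape-mod8 (suc a) (suc b) same | shape-mod6 a b
  ... | inj₁ (T , n≡8T) | s , n≡6s+2 = one≉minus-one char (injective 1# (- 1#) (begin
    D₀ n 1#                    ≡⟨ P.cong (λ m → D₀ m 1#) n≡6s+2 ⟩
    D₀ (s *ℕ 6 +ℕ 2) 1#        ≈⟨ D₀-at-one s ⟩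
    1# - (1# + 1#)             ≈⟨ +-congˡ (minus-two≈one char) ⟩
    1# + 1#                    ≈⟨ D₀-zero (- 1#) ⟨
    D₀ 0 (- 1#)                ≈⟨ D₀-at-minus-one char T 0 ⟨
    D₀ (T *ℕ 8 +ℕ 0) (- 1#)    ≡⟨ P.cong (λ m → D₀ m (- 1#)) n≡8T ⟨
    D₀ n (- 1#)                ∎))
    where n = 3 ^ suc a +ℕ 3 ^ suc b +ℕ 2
  ... | inj₂ (T , n≡8T+4) | _ = minus-one≉zero (injective (- 1#) 0# (begin
    D₀ n (- 1#)                ≡⟨ P.cong (λ m → D₀ m (- 1#)) n≡8T+4 ⟩
    D₀ (T *ℕ 8 +ℕ 4) (- 1#)    ≈⟨ D₀-at-minus-one char T 4 ⟩
    D₀ 4 (- 1#)                ≈⟨ D₀-at-minus-one-antiperiodic char 0 ⟩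
    - D₀ 0 (- 1#)              ≈⟨ -‿cong (D₀-zero (- 1#)) ⟩
    - (1# + 1#)                ≈⟨ minus-two≈one char ⟩
    1#                         ≈⟨ D₀-at-zero (T *ℕ 8 +ℕ 3) ⟨
    D₀ (suc (T *ℕ 8 +ℕ 3)) 0#  ≡⟨ P.cong (λ m → D₀ m 0#) (P.trans n≡8T+4 (ℕₚ.+-suc (T *ℕ 8) 3)) ⟨
    D₀ n 0#                    ∎))
    where n = 3 ^ suc a +ℕ 3 ^ suc b +ℕ 2

  not-permutation : ∀ e → q P.≡ 3 ^ e → ∀ a b → suc a % 2 P.≡ suc b % 2 →
    ¬ IsPermutation F (D₀ (3 ^ suc a +ℕ 3 ^ suc b +ℕ 2))
  not-permutation e q≡3ᵉ a b same (injective , _) =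
    power-size⇒base-vanishes 3 e q≡3ᵉ (λ char → D₀-not-injective char a b same injective)

open import Data.Nat using (_+_; _^_; _≥_)
open import Data.Product using (_,_)
open import Relation.Nullary using (¬_)
open import Relation.Binary.PropositionalEquality using (refl; sym; subst)
open Arithmetic using (two-powers-plus-two)

mainTheorem17 : {c ℓ : Level} (e : ℕ) → e ≥ 1 → (F : FiniteField c ℓ (3 ^ e)) →
    (l₁ l₂ l₃ l₄ : ℕ) → ExactlyTwoZero l₁ l₂ l₃ l₄ → NonzeroSameParity l₁ l₂ l₃ l₄ →
    ¬ IsPermutation F (D F (3 ^ l₁ + 3 ^ l₂ + 3 ^ l₃ + 3 ^ l₄) 0)
mainTheorem17 e _ F l₁ l₂ l₃ l₄ two-zero same-parity
  with two-powers-plus-two l₁ l₂ l₃ l₄ two-zero same-parity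
... | a , b , same , n≡ =
  subst (λ n → ¬ IsPermutation F (D F n 0)) (sym n≡) (FieldFacts.not-permutation F e refl a b same)
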